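{- Let $k \ge 2$ and let $G = N_k$ be the diamond-necklace with $k$ diamonds, of order $n = 4k$. Then $F_t(G) = \frac{1}{2}n$ and $F(G) = \frac{1}{4}n + 2$.
   Context: A diamond is $K_4$ minus an edge. For $k \ge 2$, the diamond-necklace $N_k$ is obtained from $k$ disjoint diamonds $D_1,\dots,D_k$, with $V(D_i)=\{a_i,b_i,c_i,d_i\}$ and $a_ib_i$ the missing edge of $D_i$, by adding the edges $a_ib_{i+1}$ for $i \in \{1,\dots,k-1\}$ and the edge $a_kb_1$. Forcing process: given $S \subseteq V(G)$ of initially colored vertices, at each step, if a colored vertex has exactly one non-colored neighbor, that neighbor becomes colored. $S$ is a forcing set if iterating this process colors all of $V(G)$; $F(G)$ is the minimum size of a forcing set. A total forcing set is a forcing set $S$ with $G[S]$ having no isolated vertex; $F_t(G)$ is the minimum size of a total forcing set. -}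

module Defs where

open import Data.Nat using (ℕ; zero; suc; _*_; _≤_)
open import Data.Fin using (Fin; zero; suc; toℕ; remQuot)
open import Data.Fin.Subset using (Subset; _∈_; ∣_∣)
open import Data.Bool using (Bool; true; false; T)
open import Data.Product using (_×_; Σ; ∃; _,_)
open import Data.Sum using (_⊎_)
open import Relation.Binary.PropositionalEquality using (_≡_; _≢_)

record Graph (n : ℕ) : Set₁ where
  field
    Adj : Fin n → Fin n → Set

open Graph public

-- Forcing process.  `Colored G S v` : v is colored at the end of iterating
-- the forcing rule starting from S.  Since
-- coloring is monotone, the final colored set is exactly this inductive
-- closure.

data Colored {n : ℕ} (G : Graph n) (S : Subset n) : Fin n → Set where
  initial : ∀ {v} → v ∈ S → Colored G S v
  force   : ∀ {u v} → Colored G S u → Adj G u v →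
            (∀ w → Adj G u w → w ≢ v → Colored G S w) →
            Colored G S v

IsForcingSet : {n : ℕ} → Graph n → Subset n → Set
IsForcingSet G S = ∀ v → Colored G S v

NoIsolatedIn : {n : ℕ} → Graph n → Subset n → Set
NoIsolatedIn G S = ∀ v → v ∈ S → ∃ λ u → u ∈ S × Adj G v u

IsTotalForcingSet : {n : ℕ} → Graph n → Subset n → Set
IsTotalForcingSet G S = IsForcingSet G S × NoIsolatedIn G S

IsMinSize : {n : ℕ} → (Subset n → Set) → ℕ → Set
IsMinSize P m = (Σ _ λ S → P S × ∣ S ∣ ≡ m) × (∀ S → P S → m ≤ ∣ S ∣)

ForcingNumberIs : {n : ℕ} → Graph n → ℕ → Set
ForcingNumberIs G = IsMinSize (IsForcingSet G)

TotalForcingNumberIs : {n : ℕ} → Graph n → ℕ → Set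
TotalForcingNumberIs G = IsMinSize (IsTotalForcingSet G)

-- Diamond necklace N_k.  Vertex (i , p) with i : Fin k the diamond index
-- and p : Fin 4 encoding a = 0, b = 1, c = 2, d = 3; encoded in
-- Fin (k * 4) via remQuot.

-- edges of a diamond: K4 on {a,b,c,d} minus ab
diamondEdge : Fin 4 → Fin 4 → Bool
diamondEdge zero (suc (suc _)) = true
diamondEdge (suc zero) (suc (suc _)) = true
diamondEdge (suc (suc zero)) zero = true
diamondEdge (suc (suc zero)) (suc zero) = true
diamondEdge (suc (suc zero)) (suc (suc (suc zero))) = true
diamondEdge (suc (suc (suc zero))) zero = true
diamondEdge (suc (suc (suc zero))) (suc zero) = true
diamondEdge (suc (suc (suc zero))) (suc (suc zero)) = true
diamondEdge _ _ = false

CyclicNext : {k : ℕ} → Fin k → Fin k → Set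
CyclicNext {k} i j = (suc (toℕ i) ≡ toℕ j) ⊎ (suc (toℕ i) ≡ k × toℕ j ≡ 0)

LinkEdge : {k : ℕ} → Fin k × Fin 4 → Fin k × Fin 4 → Set
LinkEdge (i , p) (j , q) = p ≡ zero × q ≡ suc zero × CyclicNext i j

NecklaceAdjPair : {k : ℕ} → Fin k × Fin 4 → Fin k × Fin 4 → Set
NecklaceAdjPair (i , p) (j , q) =
  (i ≡ j × T (diamondEdge p q)) ⊎ LinkEdge (i , p) (j , q) ⊎ LinkEdge (j , q) (i , p)

Necklace : (k : ℕ) → Graph (k * 4)
Necklace k = record { Adj = λ x y → NecklaceAdjPair {k} (remQuot {k} 4 x) (remQuot {k} 4 y) }

module Submission where

-- Lower bounds.  The two interior vertices c_i, d_i of a diamond are twins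
-- (every other vertex adjacent to one is adjacent to the other), and in any
-- graph a forcing set meets every pair of twins; so every diamond ("block")
-- contains at least one vertex of a forcing set S.
--  * Total forcing: the vertex of S in {c_i, d_i} needs a neighbour in S,
--    which lies in the same diamond, so every block has ≥ 2 vertices of S.
--  * Forcing: either S is everything, or some vertex u ∈ S performs the
--    very first force, i.e. all neighbours of u but one lie in S.  A case
--    analysis on u shows that then one block has ≥ 3 vertices of S or two
--    blocks have ≥ 2, hence |S| ≥ k + 2.
-- Upper bounds.  {a_1, c_1, b_2, c_2, …, c_k} forces N_k diamond by diamond,
-- and adding d_3, …, d_k gives a total forcing set of size 2k.

open import Defs
open import Data.Nat using (ℕ; zero; suc; _+_; _*_; _≤_; _≤?_; z≤n; s≤s; _<?_)
open import Data.Nat.Properties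
  using ( +-mono-≤; +-assoc; +-suc; +-comm; *-comm; *-identityʳ; ≤-trans; ≤-antisym; ≮⇒≥
        ; 1+n≢n; suc-injective; <-irrefl; +-0-commutativeMonoid; module ≤-Reasoning)
open import Data.Fin
  using (Fin; zero; suc; toℕ; remQuot; combine; fromℕ; fromℕ<; inject₁; punchIn; punchOut; _≟_)
open import Data.Fin.Properties
  using (remQuot-combine; combine-remQuot; toℕ-injective; toℕ-fromℕ; toℕ-fromℕ<; toℕ-inject₁; toℕ<n)
open import Data.Fin.Induction using (<-weakInduction)
open import Data.Fin.Subset using (Subset; _∈_; _∉_; ∣_∣; inside; outside)
open import Data.Fin.Subset.Properties using (x∈p⇒∣p-x∣<∣p∣; x∈p∧x≢y⇒x∈p-y; _∈?_)
open import Data.Vec using (Vec; []; _∷_; _++_; lookup; concat; group; replicate; here; there)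
open import Data.Vec.Properties using (lookup-concat; []=⇒lookup; lookup⇒[]=; lookup-replicate)
open import Data.Vec.Functional using (Vector; removeAt; tail)
open import Data.Vec.Functional.Properties using (removeAt-punchOut)
open import Algebra.Properties.CommutativeMonoid.Sum +-0-commutativeMonoid using (sum; sum-remove)
open import Data.Bool using (T)
open import Data.Unit using (tt)
open import Data.Product using (_×_; _,_; ∃; ∃₂; proj₁; proj₂; uncurry)
open import Data.Sum using (_⊎_; inj₁; inj₂; map₂; swap)
open import Data.Empty using (⊥-elim)
open import Function using (_∘_)
open import Relation.Nullary using (¬_; Dec; yes; no)
open import Relation.Nullary.Decidable using (decidable-stable)
open import Relation.Binary.PropositionalEquality
  using (_≡_; _≢_; refl; sym; trans; cong; subst; subst₂)

pattern A = zero
pattern B = suc zero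
pattern C = suc (suc zero)
pattern D = suc (suc (suc zero))

one-member : ∀ {n} {p : Subset n} {x} → x ∈ p → 1 ≤ ∣ p ∣
one-member x∈p = ≤-trans (s≤s z≤n) (x∈p⇒∣p-x∣<∣p∣ x∈p)

two-members : ∀ {n} {p : Subset n} {x y} → x ∈ p → y ∈ p → x ≢ y → 2 ≤ ∣ p ∣
two-members x∈p y∈p x≢y =
  ≤-trans (s≤s (one-member (x∈p∧x≢y⇒x∈p-y y∈p (x≢y ∘ sym)))) (x∈p⇒∣p-x∣<∣p∣ x∈p)

three-members : ∀ {n} {p : Subset n} {x y z} → x ∈ p → y ∈ p → z ∈ p →
                x ≢ y → x ≢ z → y ≢ z → 3 ≤ ∣ p ∣
three-members x∈p y∈p z∈p x≢y x≢z y≢z =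
  ≤-trans (s≤s (two-members (x∈p∧x≢y⇒x∈p-y y∈p (x≢y ∘ sym))
                            (x∈p∧x≢y⇒x∈p-y z∈p (x≢z ∘ sym)) y≢z))
          (x∈p⇒∣p-x∣<∣p∣ x∈p)

all-but-one : ∀ (p : Subset 4) q → (∀ r → r ≢ q → r ∈ p) → 3 ≤ ∣ p ∣
all-but-one p A h = three-members (h B λ ()) (h C λ ()) (h D λ ()) (λ ()) (λ ()) (λ ())
all-but-one p B h = three-members (h A λ ()) (h C λ ()) (h D λ ()) (λ ()) (λ ()) (λ ())
all-but-one p C h = three-members (h A λ ()) (h B λ ()) (h D λ ()) (λ ()) (λ ()) (λ ())
all-but-one p D h = three-members (h A λ ()) (h B λ ()) (h C λ ()) (λ ()) (λ ()) (λ ())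

card-++ : ∀ {m n} (p : Subset m) (q : Subset n) → ∣ p ++ q ∣ ≡ ∣ p ∣ + ∣ q ∣
card-++ []            q = refl
card-++ (inside  ∷ p) q = cong suc (card-++ p q)
card-++ (outside ∷ p) q = card-++ p q

card-concat : ∀ {m n} (ps : Vec (Subset m) n) → ∣ concat ps ∣ ≡ sum (λ i → ∣ lookup ps i ∣)
card-concat []       = refl
card-concat (p ∷ ps) = trans (card-++ p (concat ps)) (cong (∣ p ∣ +_) (card-concat ps))

card-concat-replicate : ∀ {m} n (p : Subset m) → ∣ concat (replicate n p) ∣ ≡ n * ∣ p ∣
card-concat-replicate zero    p = refl
card-concat-replicate (suc n) p =
  trans (card-++ p (concat (replicate n p))) (cong (∣ p ∣ +_) (card-concat-replicate n p))

∈-concat⁻ : ∀ {m n} (ps : Vec (Subset m) n) i j → combine i j ∈ concat ps → j ∈ lookup ps i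
∈-concat⁻ ps i j ij∈ =
  lookup⇒[]= j (lookup ps i) (trans (sym (lookup-concat ps i j)) ([]=⇒lookup ij∈))

∈-concat⁺ : ∀ {m n} (ps : Vec (Subset m) n) i j → j ∈ lookup ps i → combine i j ∈ concat ps
∈-concat⁺ ps i j j∈ =
  lookup⇒[]= (combine i j) (concat ps) (trans (lookup-concat ps i j) ([]=⇒lookup j∈))

∑-≥ : ∀ {n m} (t : Vector ℕ n) → (∀ i → m ≤ t i) → n * m ≤ sum t
∑-≥ {zero}  t low = z≤n
∑-≥ {suc n} t low = +-mono-≤ (low zero) (∑-≥ (tail t) (low ∘ suc))

∑-≥-one : ∀ {n m a} (t : Vector ℕ n) (i : Fin n) → (∀ j → m ≤ t j) → a + m ≤ t i →
          a + n * m ≤ sum t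
∑-≥-one {suc n} {m} {a} t i low high = begin
  a + (m + n * m)           ≡⟨ sym (+-assoc a m (n * m)) ⟩
  a + m + n * m             ≤⟨ +-mono-≤ high (∑-≥ (removeAt t i) (low ∘ punchIn i)) ⟩
  t i + sum (removeAt t i)  ≡⟨ sym (sum-remove t) ⟩
  sum t                     ∎
  where open ≤-Reasoning

∑-≥-two : ∀ {n m} (t : Vector ℕ n) (i j : Fin n) → i ≢ j → (∀ k → m ≤ t k) →
          suc m ≤ t i → suc m ≤ t j → 2 + n * m ≤ sum t
∑-≥-two {suc n} {m} t i j i≢j low high-i high-j = begin
  2 + (m + n * m)           ≡⟨ cong suc (sym (+-suc m (n * m))) ⟩
  suc m + (1 + n * m)       ≤⟨ +-mono-≤ high-i rest ⟩
  t i + sum (removeAt t i)  ≡⟨ sym (sum-remove t) ⟩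
  sum t                     ∎
  where
  open ≤-Reasoning
  high-j′ : suc m ≤ removeAt t i (punchOut i≢j)
  high-j′ = subst (suc m ≤_) (sym (removeAt-punchOut t i≢j)) high-j
  rest : 1 + n * m ≤ sum (removeAt t i)
  rest = ∑-≥-one (removeAt t i) (punchOut i≢j) (low ∘ punchIn i) high-j′

module _ {n : ℕ} (G : Graph n) {S : Subset n} where

  -- If x and y are twins (every vertex other than y adjacent to x is adjacent
  -- to y, and vice versa), every forcing set contains x or y: as long as
  -- neither is colored, a vertex adjacent to one has both as uncolored
  -- neighbours and cannot force either.
  twins-meet-forcing-set : ∀ {x y} → x ≢ y →
    (∀ w → w ≢ y → Adj G w x → Adj G w y) → (∀ w → w ≢ x → Adj G w y → Adj G w x) →
    IsForcingSet G S → x ∈ S ⊎ y ∈ S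
  twins-meet-forcing-set {x} {y} x≢y x⇒y y⇒x forcing with x ∈? S | y ∈? S
  ... | yes x∈S | _       = inj₁ x∈S
  ... | no _    | yes y∈S = inj₂ y∈S
  ... | no x∉S  | no y∉S  = ⊥-elim (proj₁ (never-colored (forcing x)) refl)
    where
    never-colored : ∀ {v} → Colored G S v → v ≢ x × v ≢ y
    never-colored (initial v∈S) = (λ { refl → x∉S v∈S }) , (λ { refl → y∉S v∈S })
    never-colored (force {u} u-col u~v others) =
      (λ { refl → proj₂ (never-colored (others y (x⇒y u (proj₂ (never-colored u-col)) u~v)
                                                  (x≢y ∘ sym))) refl }) ,
      (λ { refl → proj₁ (never-colored (others x (y⇒x u (proj₁ (never-colored u-col)) u~v)
                                                  x≢y)) refl })

  StartingForce : Set
  StartingForce = ∃₂ λ u v → u ∈ S × v ∉ S × Adj G u v × (∀ w → Adj G u w → w ≢ v → w ∈ S)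

  colored-without-start : ¬ StartingForce → ∀ {v} → Colored G S v → v ∈ S
  colored-without-start no-start (initial v∈S) = v∈S
  colored-without-start no-start (force {u} {v} u-col u~v others) with v ∈? S
  ... | yes v∈S = v∈S
  ... | no v∉S  = ⊥-elim (no-start (u , v , colored-without-start no-start u-col , v∉S , u~v ,
                    λ w u~w w≢v → colored-without-start no-start (others w u~w w≢v)))

  forcing-set-property : ∀ {P : Set} → Dec P → (StartingForce → P) → ((∀ v → v ∈ S) → P) →
                         IsForcingSet G S → P
  forcing-set-property P? from-start from-all forcing = decidable-stable P? λ ¬P →
    ¬P (from-all λ v → colored-without-start (λ start → ¬P (from-start start)) (forcing v))

cyclic-next-exists : ∀ {n} (i : Fin (suc n)) → ∃ λ j → CyclicNext i j
cyclic-next-exists {n} i with suc (toℕ i) <? suc n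
... | yes i+1<k = fromℕ< i+1<k , inj₁ (sym (toℕ-fromℕ< i+1<k))
... | no  i+1≮k = zero , inj₂ (≤-antisym (toℕ<n i) (≮⇒≥ i+1≮k) , refl)

cyclic-prev-exists : ∀ {n} (i : Fin (suc n)) → ∃ λ h → CyclicNext h i
cyclic-prev-exists {n} zero    = fromℕ n , inj₂ (cong suc (toℕ-fromℕ n) , refl)
cyclic-prev-exists     (suc i) = inject₁ i , inj₁ (cong suc (toℕ-inject₁ i))

cyclic-next-unique : ∀ {k} {i j j′ : Fin k} → CyclicNext i j → CyclicNext i j′ → j ≡ j′
cyclic-next-unique (inj₁ e) (inj₁ e′) = toℕ-injective (trans (sym e) e′)
cyclic-next-unique (inj₂ (_ , e)) (inj₂ (_ , e′)) = toℕ-injective (trans e (sym e′))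
cyclic-next-unique {j = j} (inj₁ e) (inj₂ (e′ , _)) =
  ⊥-elim (<-irrefl (trans (sym e) e′) (toℕ<n j))
cyclic-next-unique {j′ = j′} (inj₂ (e , _)) (inj₁ e′) =
  ⊥-elim (<-irrefl (trans (sym e′) e) (toℕ<n j′))

cyclic-prev-unique : ∀ {k} {h h′ i : Fin k} → CyclicNext h i → CyclicNext h′ i → h ≡ h′
cyclic-prev-unique (inj₁ e) (inj₁ e′) = toℕ-injective (suc-injective (trans e (sym e′)))
cyclic-prev-unique (inj₂ (e , _)) (inj₂ (e′ , _)) = toℕ-injective (suc-injective (trans e (sym e′)))
cyclic-prev-unique (inj₁ e) (inj₂ (_ , e′)) with () ← trans e e′
cyclic-prev-unique (inj₂ (_ , e)) (inj₁ e′) with () ← trans e′ e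

cyclic-next-≢ : ∀ {n} {i j : Fin (suc (suc n))} → CyclicNext i j → i ≢ j
cyclic-next-≢ (inj₁ e) refl = 1+n≢n e
cyclic-next-≢ (inj₂ (e , j≡0)) refl with () ← trans (sym e) (cong suc j≡0)

diamondEdge-sym : ∀ p q → diamondEdge p q ≡ diamondEdge q p
diamondEdge-sym A A = refl
diamondEdge-sym A B = refl
diamondEdge-sym A C = refl
diamondEdge-sym A D = refl
diamondEdge-sym B A = refl
diamondEdge-sym B B = refl
diamondEdge-sym B C = refl
diamondEdge-sym B D = refl
diamondEdge-sym C A = refl
diamondEdge-sym C B = refl
diamondEdge-sym C C = refl
diamondEdge-sym C D = refl
diamondEdge-sym D A = refl
diamondEdge-sym D B = refl
diamondEdge-sym D C = refl
diamondEdge-sym D D = refl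

-- c and d are the interior positions of a diamond, a and b the outer ones
-- (only outer vertices carry the edges linking consecutive diamonds).
data Interior : Fin 4 → Set where
  is-c : Interior C
  is-d : Interior D

data Outer : Fin 4 → Set where
  is-a : Outer A
  is-b : Outer B

outer≢interior : ∀ {p q} → Outer p → Interior q → p ≢ q
outer≢interior is-a is-c ()
outer≢interior is-a is-d ()
outer≢interior is-b is-c ()
outer≢interior is-b is-d ()

module NecklaceStructure (k : ℕ) where

  Pos : Set
  Pos = Fin k × Fin 4

  infix 4 _~_
  _~_ : Pos → Pos → Set
  _~_ = NecklaceAdjPair {k}

  ~-sym : ∀ {P Q} → P ~ Q → Q ~ P
  ~-sym {_ , p} {_ , q} (inj₁ (refl , e)) = inj₁ (refl , subst T (diamondEdge-sym p q) e)
  ~-sym (inj₂ (inj₁ link)) = inj₂ (inj₂ link)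
  ~-sym (inj₂ (inj₂ link)) = inj₂ (inj₁ link)

  interior-adj : ∀ {i p r} → Interior p → r ≢ p → (i , p) ~ (i , r)
  interior-adj {r = A} is-c _ = inj₁ (refl , tt)
  interior-adj {r = B} is-c _ = inj₁ (refl , tt)
  interior-adj {r = C} is-c r≢p = ⊥-elim (r≢p refl)
  interior-adj {r = D} is-c _ = inj₁ (refl , tt)
  interior-adj {r = A} is-d _ = inj₁ (refl , tt)
  interior-adj {r = B} is-d _ = inj₁ (refl , tt)
  interior-adj {r = C} is-d _ = inj₁ (refl , tt)
  interior-adj {r = D} is-d r≢p = ⊥-elim (r≢p refl)

  interior-neighbour : ∀ {i p j r} → Interior p → (i , p) ~ (j , r) → j ≡ i × r ≢ p
  interior-neighbour is-c (inj₁ (refl , e)) = refl , λ { refl → e }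
  interior-neighbour is-d (inj₁ (refl , e)) = refl , λ { refl → e }
  interior-neighbour is-c (inj₂ (inj₁ (() , _)))
  interior-neighbour is-d (inj₂ (inj₁ (() , _)))
  interior-neighbour is-c (inj₂ (inj₂ (_ , () , _)))
  interior-neighbour is-d (inj₂ (inj₂ (_ , () , _)))

  interior-twins : ∀ {i p q R} → Interior p → Interior q → R ~ (i , p) → R ≢ (i , q) → R ~ (i , q)
  interior-twins {R = _ , _} ip iq R~p R≢q with interior-neighbour ip (~-sym R~p)
  ... | refl , _ = ~-sym (interior-adj iq λ { refl → R≢q refl })

  a-neighbours : ∀ {i j R} → CyclicNext i j → (i , A) ~ R → R ≡ (i , C) ⊎ R ≡ (i , D) ⊎ R ≡ (j , B)
  a-neighbours {R = _ , C} _ (inj₁ (refl , _)) = inj₁ refl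
  a-neighbours {R = _ , D} _ (inj₁ (refl , _)) = inj₂ (inj₁ refl)
  a-neighbours next (inj₂ (inj₁ (refl , refl , next′))) =
    inj₂ (inj₂ (cong (_, B) (cyclic-next-unique next′ next)))
  a-neighbours _ (inj₂ (inj₂ (_ , () , _)))

  b-neighbours : ∀ {i j R} → CyclicNext i j → (j , B) ~ R → R ≡ (j , C) ⊎ R ≡ (j , D) ⊎ R ≡ (i , A)
  b-neighbours {R = _ , C} _ (inj₁ (refl , _)) = inj₁ refl
  b-neighbours {R = _ , D} _ (inj₁ (refl , _)) = inj₂ (inj₁ refl)
  b-neighbours _ (inj₂ (inj₁ (() , _)))
  b-neighbours next (inj₂ (inj₂ (refl , refl , next′))) =
    inj₂ (inj₂ (cong (_, A) (cyclic-prev-unique next′ next)))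

module Necklace≥2 (k′ : ℕ) where

  K : ℕ
  K = suc (suc k′)

  open NecklaceStructure K

  G : Graph (K * 4)
  G = Necklace K

  vertex : Pos → Fin (K * 4)
  vertex = uncurry combine

  position : Fin (K * 4) → Pos
  position = remQuot {K} 4

  position-vertex : ∀ P → position (vertex P) ≡ P
  position-vertex (i , p) = remQuot-combine i p

  vertex-position : ∀ x → vertex (position x) ≡ x
  vertex-position = combine-remQuot {K} 4

  adj-vertex : ∀ {x P} → position x ~ P → Adj G x (vertex P)
  adj-vertex {x} {P} = subst (position x ~_) (sym (position-vertex P))

  vertex-adj : ∀ {x P} → Adj G x (vertex P) → position x ~ P
  vertex-adj {x} {P} = subst (position x ~_) (position-vertex P)

  ∈-concat-position : ∀ (ps : Vec (Subset 4) K) {x} → x ∈ concat ps →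
                      proj₂ (position x) ∈ lookup ps (proj₁ (position x))
  ∈-concat-position ps {x} x∈ = ∈-concat⁻ ps (proj₁ (position x)) (proj₂ (position x))
    (subst (_∈ concat ps) (sym (vertex-position x)) x∈)

  -- block S i : the part of S inside diamond i.  It is kept abstract so that
  -- the splitting of S does not unfold during type inference.
  abstract
    block : Subset (K * 4) → Fin K → Subset 4
    block S = lookup (proj₁ (group K 4 S))

    card-blocks : ∀ S → ∣ S ∣ ≡ sum (λ i → ∣ block S i ∣)
    card-blocks S = trans (cong ∣_∣ (proj₂ (group K 4 S))) (card-concat (proj₁ (group K 4 S)))

  infix 4 _∈ᴾ_
  _∈ᴾ_ : Pos → Subset (K * 4) → Set
  P ∈ᴾ S = proj₂ P ∈ block S (proj₁ P)

  abstract
    in-block : ∀ {S x} → x ∈ S → position x ∈ᴾ S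
    in-block {S} {x} x∈S =
      ∈-concat-position (proj₁ (group K 4 S)) (subst (x ∈_) (proj₂ (group K 4 S)) x∈S)

  vertex-in-block : ∀ {S} P → vertex P ∈ S → P ∈ᴾ S
  vertex-in-block {S} P v∈S = subst (_∈ᴾ S) (position-vertex P) (in-block v∈S)

  module LowerBounds (S : Subset (K * 4)) (forcing : IsForcingSet G S) where

    -- Every diamond has an interior vertex in S, since c_i and d_i are twins.
    interior-member : ∀ i → ∃ λ p → Interior p × vertex (i , p) ∈ S
    interior-member i with twins-meet-forcing-set G {x = vertex (i , C)} {y = vertex (i , D)}
                             c≢d (lift-twins is-c is-d) (lift-twins is-d is-c) forcing
      where
      c≢d : vertex (i , C) ≢ vertex (i , D)
      c≢d e with () ← trans (sym (position-vertex (i , C)))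
                             (trans (cong position e) (position-vertex (i , D)))
      lift-twins : ∀ {p q} → Interior p → Interior q → ∀ w → w ≢ vertex (i , q) →
                   Adj G w (vertex (i , p)) → Adj G w (vertex (i , q))
      lift-twins {p} {q} ip iq w w≢q w~p =
        adj-vertex {w} {i , q} (interior-twins ip iq (vertex-adj {w} {i , p} w~p)
          λ e → w≢q (trans (sym (vertex-position w)) (cong vertex e)))
    ... | inj₁ c∈S = C , is-c , c∈S
    ... | inj₂ d∈S = D , is-d , d∈S

    block-≥1 : ∀ i → 1 ≤ ∣ block S i ∣
    block-≥1 i with interior-member i
    ... | p , _ , p∈S = one-member (vertex-in-block (i , p) p∈S)

    outer-≥2 : ∀ {i p} → Outer p → (i , p) ∈ᴾ S → 2 ≤ ∣ block S i ∣
    outer-≥2 {i} op p∈S with interior-member i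
    ... | q , iq , q∈S = two-members p∈S (vertex-in-block (i , q) q∈S) (outer≢interior op iq)

    Bound : Set
    Bound = K + 2 ≤ ∣ S ∣

    bound-from-sum : 2 + K * 1 ≤ sum (λ i → ∣ block S i ∣) → Bound
    bound-from-sum =
      subst₂ _≤_ (trans (cong (2 +_) (*-identityʳ K)) (+-comm 2 K)) (sym (card-blocks S))

    one-heavy : ∀ i → 3 ≤ ∣ block S i ∣ → Bound
    one-heavy i heavy = bound-from-sum (∑-≥-one {a = 2} _ i block-≥1 heavy)

    two-heavy : ∀ {i j} → i ≢ j → 2 ≤ ∣ block S i ∣ → 2 ≤ ∣ block S j ∣ → Bound
    two-heavy i≢j heavy-i heavy-j = bound-from-sum (∑-≥-two _ _ _ i≢j block-≥1 heavy-i heavy-j)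

    -- A first force from an interior vertex: its whole diamond except the
    -- forced vertex lies in S.
    interior-start : ∀ {i p Q} → Interior p → (i , p) ∈ᴾ S → (i , p) ~ Q →
                     (∀ {R} → (i , p) ~ R → R ≢ Q → R ∈ᴾ S) → Bound
    interior-start {i} {p} {_ , q} ip p∈S p~q others with interior-neighbour ip p~q
    ... | refl , _ = one-heavy i (all-but-one (block S i) q all-but-q)
      where
      all-but-q : ∀ r → r ≢ q → r ∈ block S i
      all-but-q r r≢q with r ≟ p
      ... | yes refl = p∈S
      ... | no  r≢p  = others (interior-adj ip r≢p) (λ e → r≢q (cong proj₂ e))

    -- From an outer vertex
    -- forcing inside its diamond, both its own diamond and the neighbouring one
    -- contain an outer vertex of S; forcing across the link, its own diamond
    -- lies in S except for one vertex.
    start-bound : ∀ {i p Q} → (i , p) ∈ᴾ S → (i , p) ~ Q →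
                  (∀ {R} → (i , p) ~ R → R ≢ Q → R ∈ᴾ S) → Bound
    start-bound {p = C} = interior-start is-c
    start-bound {p = D} = interior-start is-d
    start-bound {i} {A} a∈S (inj₁ (refl , edge)) others with cyclic-next-exists i
    ... | _ , next = two-heavy (cyclic-next-≢ next) (outer-≥2 is-a a∈S)
                       (outer-≥2 is-b (others (inj₂ (inj₁ (refl , refl , next))) λ { refl → edge }))
    start-bound {i} {A} a∈S (inj₂ (inj₁ (refl , refl , _))) others =
      one-heavy i (all-but-one (block S i) B λ
        { A _ → a∈S ; B B≢B → ⊥-elim (B≢B refl)
        ; C _ → others (inj₁ (refl , tt)) (λ ()) ; D _ → others (inj₁ (refl , tt)) (λ ()) })
    start-bound {p = A} _ (inj₂ (inj₂ (_ , () , _))) _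
    start-bound {i} {B} b∈S (inj₁ (refl , edge)) others with cyclic-prev-exists i
    ... | _ , prev = two-heavy (λ i≡h → cyclic-next-≢ prev (sym i≡h)) (outer-≥2 is-b b∈S)
                       (outer-≥2 is-a (others (inj₂ (inj₂ (refl , refl , prev))) λ { refl → edge }))
    start-bound {i} {B} b∈S (inj₂ (inj₂ (refl , refl , _))) others =
      one-heavy i (all-but-one (block S i) A λ
        { A A≢A → ⊥-elim (A≢A refl) ; B _ → b∈S
        ; C _ → others (inj₁ (refl , tt)) (λ ()) ; D _ → others (inj₁ (refl , tt)) (λ ()) })
    start-bound {p = B} _ (inj₂ (inj₁ (() , _))) _

    forcing-lower : Bound
    forcing-lower = forcing-set-property G (K + 2 ≤? ∣ S ∣) from-start from-all forcing
      where
      from-start : StartingForce G → Bound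
      from-start (u , v , u∈S , _ , u~v , others) = start-bound (in-block u∈S) u~v λ {R} u~R R≢v →
        vertex-in-block R (others (vertex R) (adj-vertex {u} {R} u~R)
          λ e → R≢v (trans (sym (position-vertex R)) (cong position e)))
      from-all : (∀ v → v ∈ S) → Bound
      from-all all = one-heavy zero (all-but-one (block S zero) D λ r _ →
        vertex-in-block (zero , r) (all (vertex (zero , r))))

  -- In a total forcing set the interior vertex of S in a diamond has a
  -- neighbour in S inside the same diamond, so every block has two vertices.
  total-lower : ∀ S → IsTotalForcingSet G S → 2 * K ≤ ∣ S ∣
  total-lower S (forcing , no-isolated) =
    subst₂ _≤_ (*-comm K 2) (sym (card-blocks S)) (∑-≥ _ block-≥2)
    where
    open LowerBounds S forcing
    block-≥2 : ∀ i → 2 ≤ ∣ block S i ∣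
    block-≥2 i with interior-member i
    ... | p , ip , p∈S with no-isolated (vertex (i , p)) p∈S
    ... | u , u∈S , p~u
      with interior-neighbour ip (subst (_~ position u) (position-vertex (i , p)) p~u)
    ... | refl , r≢p = two-members (vertex-in-block (i , p) p∈S) (in-block u∈S) (r≢p ∘ sym)

  module Forcing (S : Subset (K * 4)) where

    -- The vertex at position P gets colored (a record, so that P can be inferred).
    record Col (P : Pos) : Set where
      constructor colored
      field uncolor : Colored G S (vertex P)
    open Col

    force-pair : ∀ {P Q} → Col P → P ~ Q → (∀ {R} → P ~ R → R ≢ Q → Col R) → Col Q
    force-pair {P} {Q} P-col P~Q others =
      colored (force (uncolor P-col)
        (subst₂ _~_ (sym (position-vertex P)) (sym (position-vertex Q)) P~Q)
        λ w P~w w≢Q → subst (Colored G S) (vertex-position w)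
          (uncolor (others (subst (_~ position w) (position-vertex P) P~w)
                           (λ e → w≢Q (trans (sym (vertex-position w)) (cong vertex e))))))

    force-third : ∀ {P X Y Z} → Col P → P ~ Z → (∀ {R} → P ~ R → R ≡ X ⊎ R ≡ Y ⊎ R ≡ Z) →
                  Col X → Col Y → Col Z
    force-third {X = X} {Y} {Z} P-col P~Z neighbours X-col Y-col =
      force-pair P-col P~Z λ P~R R≢Z → by-cases (neighbours P~R) R≢Z
      where
      by-cases : ∀ {R} → R ≡ X ⊎ R ≡ Y ⊎ R ≡ Z → R ≢ Z → Col R
      by-cases (inj₁ refl) _ = X-col
      by-cases (inj₂ (inj₁ refl)) _ = Y-col
      by-cases (inj₂ (inj₂ refl)) R≢Z = ⊥-elim (R≢Z refl)

    interior-forces : ∀ {i p q} → Interior p → Col (i , p) → q ≢ p →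
                      (∀ r → r ≢ p → r ≢ q → Col (i , r)) → Col (i , q)
    interior-forces {i} {p} {q} ip p-col q≢p others = force-pair p-col (interior-adj ip q≢p) rest
      where
      rest : ∀ {R} → (i , p) ~ R → R ≢ (i , q) → Col R
      rest {_ , r} p~R R≢q with interior-neighbour ip p~R
      ... | refl , r≢p = others r r≢p (λ e → R≢q (cong (i ,_) e))

    Full : Fin K → Set
    Full i = ∀ p → Col (i , p)

    -- a_1, c_1, b_2 color the first diamond: a_1 forces d_1, then c_1 forces b_1.
    first-full : Col (zero , A) → Col (zero , C) → Col (suc zero , B) → Full zero
    first-full a₀ c₀ b₁ = λ { A → a₀ ; B → b₀ ; C → c₀ ; D → d₀ }
      where
      d₀ : Col (zero , D)
      d₀ = force-third a₀ (inj₁ (refl , tt)) (λ e → map₂ swap (a-neighbours (inj₁ refl) e)) c₀ b₁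
      b₀ : Col (zero , B)
      b₀ = interior-forces is-c c₀ (λ ())
        λ { A _ _ → a₀ ; B _ B≢B → ⊥-elim (B≢B refl) ; C C≢C _ → ⊥-elim (C≢C refl) ; D _ _ → d₀ }

    -- A colored diamond and c_j color the next diamond j: a_i forces b_j,
    -- b_j forces d_j, then c_j forces a_j.
    next-full : ∀ {i j} → CyclicNext i j → Full i → Col (j , C) → Full j
    next-full {i} {j} next full-i cⱼ = λ { A → aⱼ ; B → bⱼ ; C → cⱼ ; D → dⱼ }
      where
      bⱼ : Col (j , B)
      bⱼ = force-third (full-i A) (inj₂ (inj₁ (refl , refl , next))) (a-neighbours next)
                       (full-i C) (full-i D)
      dⱼ : Col (j , D)
      dⱼ = force-third bⱼ (inj₁ (refl , tt)) (λ e → map₂ swap (b-neighbours next e)) cⱼ (full-i A)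
      aⱼ : Col (j , A)
      aⱼ = interior-forces is-c cⱼ (λ ())
        λ { A _ A≢A → ⊥-elim (A≢A refl) ; B _ _ → bⱼ ; C C≢C _ → ⊥-elim (C≢C refl) ; D _ _ → dⱼ }

    forcing-set : vertex (zero , A) ∈ S → vertex (suc zero , B) ∈ S → (∀ i → vertex (i , C) ∈ S) →
                  IsForcingSet G S
    forcing-set a₀ b₁ cs v =
      subst (Colored G S) (vertex-position v)
        (uncolor (all-full (proj₁ (position v)) (proj₂ (position v))))
      where
      all-full : ∀ i → Full i
      all-full = <-weakInduction Full
        (first-full (colored (initial a₀)) (colored (initial (cs zero))) (colored (initial b₁)))
        λ i full-i → next-full (inj₁ (cong suc (toℕ-inject₁ i))) full-i
                               (colored (initial (cs (suc i))))

  -- The sets {a_1, c_1, b_2, c_2} ∪ t_3 ∪ … ∪ t_k, for t the part taken in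
  -- each later diamond: t = {c} gives F, t = {c, d} gives F_t.
  ac bc cd c-only : Subset 4
  ac     = inside  ∷ outside ∷ inside ∷ outside ∷ []
  bc     = outside ∷ inside  ∷ inside ∷ outside ∷ []
  cd     = outside ∷ outside ∷ inside ∷ inside  ∷ []
  c-only = outside ∷ outside ∷ inside ∷ outside ∷ []

  blocks-with : Subset 4 → Vec (Subset 4) K
  blocks-with t = ac ∷ bc ∷ replicate k′ t

  necklace-set : Subset 4 → Subset (K * 4)
  necklace-set t = concat (blocks-with t)

  card-necklace-set : ∀ t → ∣ necklace-set t ∣ ≡ 2 + (2 + k′ * ∣ t ∣)
  card-necklace-set t =
    trans (card-++ ac (concat (bc ∷ replicate k′ t))) (cong (2 +_)
      (trans (card-++ bc (concat (replicate k′ t))) (cong (2 +_) (card-concat-replicate k′ t))))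

  necklace-set-forcing : ∀ t → C ∈ t → IsForcingSet G (necklace-set t)
  necklace-set-forcing t C∈t = Forcing.forcing-set (necklace-set t)
    (∈-concat⁺ (blocks-with t) zero A here)
    (∈-concat⁺ (blocks-with t) (suc zero) B (there here))
    (λ i → ∈-concat⁺ (blocks-with t) i C (C-in i))
    where
    C-in : ∀ i → C ∈ lookup (blocks-with t) i
    C-in zero = there (there here)
    C-in (suc zero) = there (there here)
    C-in (suc (suc i)) = subst (C ∈_) (sym (lookup-replicate i t)) C∈t

  EdgeBlock : Subset 4 → Set
  EdgeBlock t = ∀ {p} → p ∈ t → ∃ λ q → q ∈ t × T (diamondEdge p q)

  total-blocks-are-edges : ∀ i → EdgeBlock (lookup (blocks-with cd) i)
  total-blocks-are-edges zero here = C , there (there here) , tt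
  total-blocks-are-edges zero (there (there here)) = A , here , tt
  total-blocks-are-edges zero (there (there (there (there ()))))
  total-blocks-are-edges (suc zero) (there here) = C , there (there here) , tt
  total-blocks-are-edges (suc zero) (there (there here)) = B , there here , tt
  total-blocks-are-edges (suc zero) (there (there (there (there ()))))
  total-blocks-are-edges (suc (suc i)) rewrite lookup-replicate i cd = cd-edge
    where
    cd-edge : EdgeBlock cd
    cd-edge (there (there here)) = D , there (there (there here)) , tt
    cd-edge (there (there (there here))) = C , there (there here) , tt

  total-set-no-isolated : NoIsolatedIn G (necklace-set cd)
  total-set-no-isolated v v∈S
    with total-blocks-are-edges (proj₁ (position v)) (∈-concat-position (blocks-with cd) v∈S)
  ... | q , q∈ , edge = vertex (proj₁ (position v) , q) ,
                        ∈-concat⁺ (blocks-with cd) (proj₁ (position v)) q q∈ ,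
                        adj-vertex {v} {proj₁ (position v) , q} (inj₁ (refl , edge))

  total-forcing-number : TotalForcingNumberIs G (2 * K)
  total-forcing-number =
    (necklace-set cd , (necklace-set-forcing cd (there (there here)) , total-set-no-isolated) ,
     trans (card-necklace-set cd) (*-comm K 2)) ,
    total-lower

  forcing-number : ForcingNumberIs G (K + 2)
  forcing-number =
    (necklace-set c-only , necklace-set-forcing c-only (there (there here)) ,
     trans (card-necklace-set c-only)
           (cong (2 +_) (trans (cong (2 +_) (*-identityʳ k′)) (+-comm 2 k′)))) ,
    LowerBounds.forcing-lower

lemma1 : (k : ℕ) → 2 ≤ k →
    TotalForcingNumberIs (Necklace k) (2 * k) × ForcingNumberIs (Necklace k) (k + 2)
lemma1 (suc (suc k′)) _ = Necklace≥2.total-forcing-number k′ , Necklace≥2.forcing-number k′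
lemma1 (suc zero) (s≤s ())
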